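{- Let $p$ be a prime, $n\ge1$, and $\alpha$ an integer with $p$-adic expansion $\alpha\equiv(\alpha_1,\dots,\alpha_n)$ modulo $p^n-1$. Then for every $1\le a\le p-1$, $$s(\alpha+\widehat{p-a})=s(\alpha)+(p-a)n-v_a(\alpha)(p-1).$$
   Context: Write $\alpha\equiv(\alpha_1,\dots,\alpha_n)$ if $\alpha\equiv\sum_{i=1}^n\alpha_ip^{i-1}\pmod{p^n-1}$ with $0\le\alpha_i\le p-1$; indices are extended to all integers by $\alpha_j=\alpha_i$ when $j\equiv i\pmod n$. $s(\alpha)=\sum_i\alpha_i$, and for an integer $k$, $\hat k=k\frac{p^n-1}{p-1}$. The $a$-th directed graph $\mathcal{G}_a(\alpha)$ has vertices $\alpha_1,\dots,\alpha_n$ (one per position $k$, cyclically) and edges: if $\alpha_k<a-1$ no edge is attached to $\alpha_k$; if $\alpha_k\ge a$ and $\alpha_{k+1}\ge a-1$ there is a directed edge $\alpha_k\to\alpha_{k+1}$; if $\alpha_k=\alpha_{k+1}=a-1$ there is an edge $\alpha_k\to\alpha_{k+1}$ exactly when there is an edge $\alpha_{k-1}\to\alpha_k$. Let $\mathcal{G}_a(\alpha)^\circ$ be the union of the connected components of $\mathcal{G}_a(\alpha)$ containing at least one vertex $\ge a$, and $v_a(\alpha)$ its number of vertices. -}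

module Defs where

open import Data.Nat using (ℕ; zero; suc; _+_; _*_; _∸_; _^_; _≤_; _<_; NonZero; _%_)
open import Data.Nat.DivMod using (m%n<n)
open import Data.Fin using (Fin; toℕ; fromℕ<)
open import Data.List using (tabulate)
open import Data.Nat.ListAction using (sum)
open import Data.Product using (∃; ∃₂; _×_)
open import Relation.Binary.PropositionalEquality using (_≡_)

-- s(α) : digit sum of a digit vector (α₁,…,αₙ), stored 0-based as α : Fin n → ℕ
s : ∀ {n} → (Fin n → ℕ) → ℕ
s α = sum (tabulate α)

value : ∀ {n} → ℕ → (Fin n → ℕ) → ℕ
value p α = sum (tabulate (λ i → α i * p ^ toℕ i))

-- k̂ = k (pⁿ-1)/(p-1) = k (1 + p + … + p^(n-1))
hat : ℕ → ℕ → ℕ → ℕ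
hat p n k = k * sum (tabulate {n = n} (λ i → p ^ toℕ i))

_≡_[mod_] : ℕ → ℕ → ℕ → Set
x ≡ y [mod m ] = ∃₂ λ u w → x + u * m ≡ y + w * m

digit : ∀ {n} .{{_ : NonZero n}} → (Fin n → ℕ) → ℕ → ℕ
digit {n} α k = α (fromℕ< (m%n<n k n))

-- Edge a δ n k : there is a directed edge from vertex k to vertex k+1 in 𝒢_a
-- (δ = cyclically extended digits, n = period).  Least relation closed under
-- the rules of the definition; 'wrap' identifies position k with k+n.
data Edge (a : ℕ) (δ : ℕ → ℕ) (n : ℕ) : ℕ → Set where
  base  : ∀ {k} → a ≤ δ k → a ∸ 1 ≤ δ (suc k) → Edge a δ n k
  chain : ∀ {k} → δ (suc k) ≡ a ∸ 1 → δ (suc (suc k)) ≡ a ∸ 1 →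
          Edge a δ n k → Edge a δ n (suc k)
  wrap  : ∀ {k} → Edge a δ n (k + n) → Edge a δ n k

-- Conn a δ n k j : vertices k and j lie in the same connected component of
-- 𝒢_a (undirected paths along edges; positions taken modulo n)
data Conn (a : ℕ) (δ : ℕ → ℕ) (n : ℕ) : ℕ → ℕ → Set where
  here : ∀ {k} → Conn a δ n k k
  fwd  : ∀ {k j} → Edge a δ n k → Conn a δ n (suc k) j → Conn a δ n k j
  bwd  : ∀ {k j} → Edge a δ n k → Conn a δ n k j → Conn a δ n (suc k) j
  up   : ∀ {k j} → Conn a δ n (k + n) j → Conn a δ n k j
  down : ∀ {k j} → Conn a δ n k j → Conn a δ n (k + n) j

-- vertex k belongs to 𝒢_a(α)° : its component contains a vertex ≥ a
InCirc : ∀ {n} .{{_ : NonZero n}} → ℕ → (Fin n → ℕ) → ℕ → Set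
InCirc {n} a α k = ∃ λ j → Conn a (digit α) n k j × a ≤ digit α j

{-# OPTIONS --safe #-}

-- Adding ĉ = c (1 + p + ⋯ + p^(n−1)), with c = p − a, to α is a cyclic column addition:
-- column k receives δ k + c plus the carry out of column k − 1, and the carry out of the top
-- column re-enters column 0 because pⁿ ≡ 1 modulo pⁿ − 1.  Column k carries exactly when
-- δ k ≥ a, or δ k = a − 1 and column k − 1 carries; unwinding this recursion, the carrying
-- columns are the vertices ending a directed path of 𝒢_a that starts at a vertex ≥ a, i.e. the
-- vertices of 𝒢_a(α)°.  Each carry trades p units of one column for one unit of the next, so
-- the digit sum is s(α) + cn − (p − 1) v_a(α).  The resulting digits are not all zero, and a
-- nonzero n-digit number is determined by its residue modulo pⁿ − 1, so they are the digits of β.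
module Submission where

open import Defs
open import Data.Bool.Base using (Bool; true; false)
open import Data.Fin.Base using (Fin; toℕ; fromℕ<) renaming (zero to fzero; suc to fsuc)
open import Data.Fin.Properties using (toℕ-fromℕ<; fromℕ<-cong; toℕ-injective; toℕ<n)
open import Data.Fin.Subset using (Subset; _∈_; ∣_∣)
open import Data.List.Base using (tabulate)
open import Data.Nat.Base
open import Data.Nat.DivMod
  using (m%n<n; m≡m%n+[m/n]*n; [m+n]%n≡m%n; m%n%n≡m%n; [m+kn]%n≡m%n; m<n⇒m%n≡m; m<n⇒m/n≡0; m/n≡1+[m∸n]/n)
open import Data.Nat.ListAction using (sum)
open import Data.Nat.Primality using (Prime)
open import Data.Nat.Properties
open import Data.Nat.Tactic.RingSolver using (solve-∀)
open import Data.Product.Base using (∃; _×_; _,_; proj₁; proj₂)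
open import Data.Product.Function.NonDependent.Propositional using (_×-⇔_)
open import Data.Sum.Base using (_⊎_; inj₁; inj₂; [_,_])
open import Data.Sum.Function.Propositional using (_⊎-⇔_)
open import Data.Vec.Base using ([]; _∷_; lookup)
open import Data.Vec.Properties using ([]=⇒lookup; lookup⇒[]=)
open import Function.Base using (_∘_)
open import Function.Bundles using (_⇔_; mk⇔; Equivalence)
open import Function.Properties.Equivalence using () renaming (refl to ⇔-refl; sym to ⇔-sym)
open import Function.Related.Propositional using (module EquationalReasoning)
open import Relation.Binary.PropositionalEquality hiding ([_])
open import Relation.Nullary.Negation using (¬_; contradiction)

open import Algebra.Properties.CommutativeSemigroup +-commutativeSemigroup
  using (interchange; xy∙z≈xz∙y; xy∙z≈x∙zy)

∑ : ℕ → (ℕ → ℕ) → ℕ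
∑ zero    f = 0
∑ (suc n) f = f 0 + ∑ n (f ∘ suc)

∑-cong : ∀ n {f g} → (∀ k → k < n → f k ≡ g k) → ∑ n f ≡ ∑ n g
∑-cong zero    eq = refl
∑-cong (suc n) eq = cong₂ _+_ (eq 0 z<s) (∑-cong n (λ k k<n → eq (suc k) (s<s k<n)))

∑-distrib-+ : ∀ n f g → ∑ n (λ k → f k + g k) ≡ ∑ n f + ∑ n g
∑-distrib-+ zero    f g = refl
∑-distrib-+ (suc n) f g =
  trans (cong (f 0 + g 0 +_) (∑-distrib-+ n (f ∘ suc) (g ∘ suc))) (interchange (f 0) (g 0) _ _)

∑-*ˡ : ∀ n c f → ∑ n (λ k → c * f k) ≡ c * ∑ n f
∑-*ˡ zero    c f = sym (*-zeroʳ c)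
∑-*ˡ (suc n) c f = trans (cong (c * f 0 +_) (∑-*ˡ n c (f ∘ suc))) (sym (*-distribˡ-+ c (f 0) _))

∑-*ʳ : ∀ n f c → ∑ n (λ k → f k * c) ≡ ∑ n f * c
∑-*ʳ n f c = trans (∑-cong n (λ k _ → *-comm (f k) c)) (trans (∑-*ˡ n c f) (*-comm c (∑ n f)))

∑-const : ∀ n c → ∑ n (λ _ → c) ≡ c * n
∑-const zero    c = sym (*-zeroʳ c)
∑-const (suc n) c = trans (cong (c +_) (∑-const n c)) (sym (*-suc c n))

∑-suc : ∀ n f → ∑ (suc n) f ≡ ∑ n f + f n
∑-suc zero    f = +-comm (f 0) 0
∑-suc (suc n) f = trans (cong (f 0 +_) (∑-suc n (f ∘ suc))) (sym (+-assoc (f 0) _ _))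

∑-rotate : ∀ n f → (∀ k → f (k + n) ≡ f k) → ∀ m → ∑ n (λ k → f (k + m)) ≡ ∑ n f
∑-rotate n f f-periodic zero    = ∑-cong n (λ k _ → cong f (+-identityʳ k))
∑-rotate n f f-periodic (suc m) = begin
  ∑ n (λ k → f (k + suc m)) ≡⟨ ∑-cong n (λ k _ → cong f (+-suc k m)) ⟩
  ∑ n (g ∘ suc)             ≡⟨ +-cancelˡ-≡ (g 0) _ _ rotate-once ⟩
  ∑ n g                     ≡⟨ ∑-rotate n f f-periodic m ⟩
  ∑ n f                     ∎
  where
  open ≡-Reasoning
  g : ℕ → ℕ
  g k = f (k + m)
  rotate-once : g 0 + ∑ n (g ∘ suc) ≡ g 0 + ∑ n g
  rotate-once = begin
    ∑ (suc n) g   ≡⟨ ∑-suc n g ⟩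
    ∑ n g + g n   ≡⟨ cong (∑ n g +_) (trans (cong f (+-comm n m)) (f-periodic m)) ⟩
    ∑ n g + g 0   ≡⟨ +-comm (∑ n g) (g 0) ⟩
    g 0 + ∑ n g   ∎

sum-tabulate : ∀ {n} (f : Fin n → ℕ) (g : ℕ → ℕ) → (∀ i → f i ≡ g (toℕ i)) → sum (tabulate f) ≡ ∑ n g
sum-tabulate {zero}  f g eq = refl
sum-tabulate {suc n} f g eq = cong₂ _+_ (eq fzero) (sum-tabulate (f ∘ fsuc) (g ∘ suc) (eq ∘ fsuc))

module _ {A : Set} {n : ℕ} .{{_ : NonZero n}} where

  cyclic : (Fin n → A) → ℕ → A
  cyclic f k = f (fromℕ< (m%n<n k n))

  cyclic-+n : ∀ f k → cyclic f (k + n) ≡ cyclic f k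
  cyclic-+n f k = cong f (fromℕ<-cong _ _ ([m+n]%n≡m%n k n) _ _)

  cyclic-% : ∀ f k → cyclic f (k % n) ≡ cyclic f k
  cyclic-% f k = cong f (fromℕ<-cong _ _ (m%n%n≡m%n k n) _ _)

  cyclic-toℕ : ∀ f i → cyclic f (toℕ i) ≡ f i
  cyclic-toℕ f i = cong f (toℕ-injective (trans (toℕ-fromℕ< _) (m<n⇒m%n≡m (toℕ<n i))))

s≡∑cyclic : ∀ {n} .{{_ : NonZero n}} (f : Fin n → ℕ) → s f ≡ ∑ n (cyclic f)
s≡∑cyclic f = sum-tabulate f (cyclic f) (λ i → sym (cyclic-toℕ f i))

𝟙 : Bool → ℕ
𝟙 false = 0
𝟙 true  = 1

∣S∣≡s𝟙 : ∀ {n} (S : Subset n) → ∣ S ∣ ≡ s (𝟙 ∘ lookup S)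
∣S∣≡s𝟙 []          = refl
∣S∣≡s𝟙 (true ∷ S)  = cong suc (∣S∣≡s𝟙 S)
∣S∣≡s𝟙 (false ∷ S) = ∣S∣≡s𝟙 S

positional : ℕ → ℕ → (ℕ → ℕ) → ℕ
positional p n f = ∑ n (λ k → f k * p ^ k)

value≡positional : ∀ p {n} .{{_ : NonZero n}} (f : Fin n → ℕ) → value p f ≡ positional p n (cyclic f)
value≡positional p f = sum-tabulate _ _ (λ i → cong (_* p ^ toℕ i) (sym (cyclic-toℕ f i)))

positional-suc : ∀ p n f → positional p (suc n) f ≡ f 0 + positional p n (f ∘ suc) * p
positional-suc p n f = cong₂ _+_ (*-identityʳ (f 0)) (begin
  ∑ n (λ k → f (suc k) * (p * p ^ k)) ≡⟨ ∑-cong n (λ k _ → shift (f (suc k)) p (p ^ k)) ⟩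
  ∑ n (λ k → f (suc k) * p ^ k * p)   ≡⟨ ∑-*ʳ n (λ k → f (suc k) * p ^ k) p ⟩
  positional p n (f ∘ suc) * p        ∎)
  where
  open ≡-Reasoning
  shift : ∀ x p q → x * (p * q) ≡ x * q * p
  shift = solve-∀

positional-+hat : ∀ p n f c → positional p n (λ k → f k + c) ≡ positional p n f + hat p n c
positional-+hat p n f c = begin
  ∑ n (λ k → (f k + c) * p ^ k)         ≡⟨ ∑-cong n (λ k _ → *-distribʳ-+ (p ^ k) (f k) c) ⟩
  ∑ n (λ k → f k * p ^ k + c * p ^ k)   ≡⟨ ∑-distrib-+ n _ _ ⟩
  positional p n f + ∑ n (λ k → c * p ^ k)
    ≡⟨ cong (positional p n f +_) (trans (∑-*ˡ n c (p ^_)) (cong (c *_) (sym powers))) ⟩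
  positional p n f + hat p n c          ∎
  where
  open ≡-Reasoning
  powers : sum (tabulate {n = n} (λ i → p ^ toℕ i)) ≡ ∑ n (p ^_)
  powers = sum-tabulate {n = n} (λ i → p ^ toℕ i) (p ^_) (λ _ → refl)

positional<pⁿ : ∀ p n {f} → (∀ k → f k < p) → positional p n f < p ^ n
positional<pⁿ p zero    f<p = z<s
positional<pⁿ p (suc n) {f} f<p = begin-strict
  positional p (suc n) f ≡⟨ positional-suc p n f ⟩
  f 0 + v * p            <⟨ +-monoˡ-< (v * p) (f<p 0) ⟩
  suc v * p              ≤⟨ *-monoˡ-≤ p (positional<pⁿ p n (f<p ∘ suc)) ⟩
  p ^ n * p              ≡⟨ *-comm (p ^ n) p ⟩
  p ^ suc n              ∎
  where
  open ≤-Reasoning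
  v : ℕ
  v = positional p n (f ∘ suc)

residue-unique : ∀ {x y m} u w → x < m → y < m → x + u * m ≡ y + w * m → x ≡ y
residue-unique {x} {y} {m} u w x<m y<m eq = begin
  x               ≡⟨ m<n⇒m%n≡m x<m ⟨
  x % m           ≡⟨ [m+kn]%n≡m%n x u m ⟨
  (x + u * m) % m ≡⟨ cong (_% m) eq ⟩
  (y + w * m) % m ≡⟨ [m+kn]%n≡m%n y w m ⟩
  y % m           ≡⟨ m<n⇒m%n≡m y<m ⟩
  y               ∎
  where
  open ≡-Reasoning
  instance _ = >-nonZero (m<n⇒0<n x<m)

positive-residue-unique : ∀ {x y m} u w → 0 < x → 0 < y → x ≤ m → y ≤ m → x + u * m ≡ y + w * m → x ≡ y
positive-residue-unique {suc x} {suc y} u w _ _ x<m y<m eq = cong suc (residue-unique u w x<m y<m (suc-injective eq))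

+*-unique : ∀ {p a b} .{{_ : NonZero p}} x y → a < p → b < p → a + x * p ≡ b + y * p → a ≡ b × x ≡ y
+*-unique {p} {a} x y a<p b<p eq with residue-unique x y a<p b<p eq
... | refl = refl , *-cancelʳ-≡ x y p (+-cancelˡ-≡ a (x * p) (y * p) eq)

positional-injective : ∀ {p} .{{_ : NonZero p}} n {f g} → (∀ k → f k < p) → (∀ k → g k < p) →
                       positional p n f ≡ positional p n g → ∀ k → k < n → f k ≡ g k
positional-injective {p} (suc n) {f} {g} f<p g<p eq k k<n
  with +*-unique (positional p n (f ∘ suc)) (positional p n (g ∘ suc)) (f<p 0) (g<p 0) (trans (sym (positional-suc p n f)) (trans eq (positional-suc p n g)))
positional-injective (suc n) f<p g<p eq zero    _         | f0≡g0 , _ = f0≡g0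
positional-injective (suc n) f<p g<p eq (suc k) (s<s k<n) | _ , eq′ =
  positional-injective n (f<p ∘ suc) (g<p ∘ suc) eq′ k k<n

positional-≡-mod-injective : ∀ {p} .{{_ : NonZero p}} n {f g} u w → (∀ k → f k < p) → (∀ k → g k < p) →
  0 < positional p n f → 0 < positional p n g →
  positional p n f + u * (p ^ n ∸ 1) ≡ positional p n g + w * (p ^ n ∸ 1) → ∀ k → k < n → f k ≡ g k
positional-≡-mod-injective {p} n u w f<p g<p f>0 g>0 eq = positional-injective n f<p g<p
  (positive-residue-unique u w f>0 g>0
    (∸-monoˡ-≤ 1 (positional<pⁿ p n f<p)) (∸-monoˡ-≤ 1 (positional<pⁿ p n g<p)) eq)

-- The carry into column k is X (k + m), as k + m is k − 1 modulo suc m.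
module EndAroundCarry (p m : ℕ) (u r X : ℕ → ℕ) (X-periodic : ∀ k → X (k + suc m) ≡ X k)
                      (column : ∀ k → u k + X (k + m) ≡ r k + X k * p) where

  private
    n : ℕ
    n = suc m

  ∑-end-around : ∑ n r + ∑ n X * p ≡ ∑ n u + ∑ n X
  ∑-end-around = begin
    ∑ n r + ∑ n X * p             ≡⟨ cong (∑ n r +_) (∑-*ʳ n X p) ⟨
    ∑ n r + ∑ n (λ k → X k * p)   ≡⟨ ∑-distrib-+ n r (λ k → X k * p) ⟨
    ∑ n (λ k → r k + X k * p)     ≡⟨ ∑-cong n (λ k _ → column k) ⟨
    ∑ n (λ k → u k + X (k + m))   ≡⟨ ∑-distrib-+ n u (λ k → X (k + m)) ⟩
    ∑ n u + ∑ n (λ k → X (k + m)) ≡⟨ cong (∑ n u +_) (∑-rotate n X X-periodic m) ⟩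
    ∑ n u + ∑ n X                 ∎
    where open ≡-Reasoning

  positional-end-around : positional p n r + X m * p ^ n ≡ positional p n u + X m
  positional-end-around = +-cancelʳ-≡ W _ _ (begin
    positional p n r + X m * p ^ n + W              ≡⟨ xy∙z≈x∙zy (positional p n r) (X m * p ^ n) W ⟩
    positional p n r + (W + X m * p ^ n)            ≡⟨ cong (positional p n r +_) (∑-suc m (λ k → X k * p ^ suc k)) ⟨
    positional p n r + ∑ n (λ k → X k * p ^ suc k)  ≡⟨ ∑-distrib-+ n (λ k → r k * p ^ k) (λ k → X k * p ^ suc k) ⟨
    ∑ n (λ k → r k * p ^ k + X k * p ^ suc k)       ≡⟨ ∑-cong n (λ k _ → column-value k) ⟩
    ∑ n (λ k → u k * p ^ k + X (k + m) * p ^ k)     ≡⟨ ∑-distrib-+ n (λ k → u k * p ^ k) (λ k → X (k + m) * p ^ k) ⟩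
    positional p n u + ∑ n (λ k → X (k + m) * p ^ k) ≡⟨ cong (positional p n u +_) carries-in ⟩
    positional p n u + (X m * 1 + W)                ≡⟨ +-*1-assoc _ (X m) W ⟩
    positional p n u + X m + W                      ∎)
    where
    open ≡-Reasoning
    W : ℕ
    W = ∑ m (λ k → X k * p ^ suc k)
    +-*1-assoc : ∀ a b c → a + (b * 1 + c) ≡ a + b + c
    +-*1-assoc = solve-∀
    column-value : ∀ k → r k * p ^ k + X k * p ^ suc k ≡ u k * p ^ k + X (k + m) * p ^ k
    column-value k = begin
      r k * p ^ k + X k * (p * p ^ k) ≡⟨ factor (r k) (X k) p (p ^ k) ⟩
      (r k + X k * p) * p ^ k         ≡⟨ cong (_* p ^ k) (column k) ⟨
      (u k + X (k + m)) * p ^ k       ≡⟨ *-distribʳ-+ (p ^ k) (u k) _ ⟩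
      u k * p ^ k + X (k + m) * p ^ k ∎
      where
      factor : ∀ a b p q → a * q + b * (p * q) ≡ (a + b * p) * q
      factor = solve-∀
    carries-in : ∑ n (λ k → X (k + m) * p ^ k) ≡ X m * 1 + W
    carries-in = cong (X m * 1 +_) (∑-cong m (λ k _ → cong (_* p ^ suc k)
      (trans (cong X (sym (+-suc k m))) (X-periodic k))))

𝟙≡/ : ∀ {p t} .{{_ : NonZero p}} b → t < p + p → (b ≡ true ⇔ p ≤ t) → 𝟙 b ≡ t / p
𝟙≡/ {p} {t} true t<2p b⇔ = sym (begin
  t / p           ≡⟨ m/n≡1+[m∸n]/n (Equivalence.to b⇔ refl) ⟩
  1 + (t ∸ p) / p ≡⟨ cong suc (m<n⇒m/n≡0 (m<n+o⇒m∸n<o t p t<2p)) ⟩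
  1               ∎)
  where open ≡-Reasoning
𝟙≡/ false t<2p b⇔ = sym (m<n⇒m/n≡0 (≰⇒> (λ p≤t → contradiction (Equivalence.from b⇔ p≤t) λ ())))

∸1≤⇒≤⊎≡∸1 : ∀ {a d} → a ∸ 1 ≤ d → a ≤ d ⊎ d ≡ a ∸ 1
∸1≤⇒≤⊎≡∸1 {zero}  _   = inj₁ z≤n
∸1≤⇒≤⊎≡∸1 {suc a} a≤d with m≤n⇒m<n∨m≡n a≤d
... | inj₁ a<d  = inj₁ a<d
... | inj₂ refl = inj₂ refl

≤+𝟙⇔ : ∀ a d b → (a ≤ d ⊎ (d ≡ a ∸ 1 × b ≡ true)) ⇔ a ≤ d + 𝟙 b
≤+𝟙⇔ a d false = mk⇔ [ (λ a≤d → ≤-trans a≤d (m≤m+n d 0)) , (λ ()) ∘ proj₂ ]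
                     (inj₁ ∘ subst (a ≤_) (+-identityʳ d))
≤+𝟙⇔ a d true  = mk⇔ to from
  where
  to : a ≤ d ⊎ (d ≡ a ∸ 1 × true ≡ true) → a ≤ d + 1
  to (inj₁ a≤d)        = ≤-trans a≤d (m≤m+n d 1)
  to (inj₂ (refl , _)) = subst (a ≤_) (+-comm 1 (a ∸ 1)) (m≤n+m∸n a 1)
  from : a ≤ d + 1 → a ≤ d ⊎ (d ≡ a ∸ 1 × true ≡ true)
  from a≤d+1 with ∸1≤⇒≤⊎≡∸1 (m≤n+o⇒m∸n≤o a 1 (subst (a ≤_) (+-comm d 1) a≤d+1))
  ... | inj₁ a≤d  = inj₁ a≤d
  ... | inj₂ d≡a∸1 = inj₂ (d≡a∸1 , refl)

module Components (a : ℕ) (δ : ℕ → ℕ) (n : ℕ) (δ-periodic : ∀ k → δ (k + n) ≡ δ k) where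

  data Reached : ℕ → Set where
    source : ∀ {k} → a ≤ δ k → Reached k
    extend : ∀ {k} → δ (suc k) ≡ a ∸ 1 → Reached k → Reached (suc k)
    wrap   : ∀ {k} → Reached (k + n) → Reached k

  InComponent : ℕ → Set
  InComponent k = ∃ λ j → Conn a δ n k j × a ≤ δ j

  Reached-+n : ∀ {k} → Reached k → Reached (k + n)
  Reached-+n {k} (source a≤δk) = source (subst (a ≤_) (sym (δ-periodic k)) a≤δk)
  Reached-+n (extend {k} e r)  = extend (trans (δ-periodic (suc k)) e) (Reached-+n r)
  Reached-+n (wrap r)          = r

  Reached-+*n⇔ : ∀ k t → Reached (k + t * n) ⇔ Reached k
  Reached-+*n⇔ k zero    = subst (λ j → Reached j ⇔ Reached k) (sym (+-identityʳ k)) ⇔-refl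
  Reached-+*n⇔ k (suc t) = begin
    Reached (k + (n + t * n)) ≡⟨ cong Reached (trans (sym (+-assoc k n _)) (xy∙z≈xz∙y k n (t * n))) ⟩
    Reached (k + t * n + n)   ∼⟨ mk⇔ wrap Reached-+n ⟩
    Reached (k + t * n)       ∼⟨ Reached-+*n⇔ k t ⟩
    Reached k                 ∎
    where open EquationalReasoning

  Reached-%⇔ : .{{_ : NonZero n}} → ∀ k → Reached (k % n) ⇔ Reached k
  Reached-%⇔ k = subst (λ j → Reached (k % n) ⇔ Reached j) (sym (m≡m%n+[m/n]*n k n))
                       (⇔-sym (Reached-+*n⇔ (k % n) (k / n)))

  Edge⇒Reached : ∀ {k} → Edge a δ n k → Reached k × Reached (suc k)
  Edge⇒Reached (base a≤δk a∸1≤δk+1) =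
    source a≤δk , [ source , (λ e → extend e (source a≤δk)) ] (∸1≤⇒≤⊎≡∸1 a∸1≤δk+1)
  Edge⇒Reached (chain _ e E) = proj₂ (Edge⇒Reached E) , extend e (proj₂ (Edge⇒Reached E))
  Edge⇒Reached (wrap E)      = wrap (proj₁ (Edge⇒Reached E)) , wrap (proj₂ (Edge⇒Reached E))

  -- Both ends of an edge are Reached, so the hypothesis on j only matters for the trivial path.
  Conn⇒Reached : ∀ {k j} → Conn a δ n k j → Reached j → Reached k
  Conn⇒Reached here      r = r
  Conn⇒Reached (fwd e _) _ = proj₁ (Edge⇒Reached e)
  Conn⇒Reached (bwd e _) _ = proj₂ (Edge⇒Reached e)
  Conn⇒Reached (up c)    r = wrap (Conn⇒Reached c r)
  Conn⇒Reached (down c)  r = Reached-+n (Conn⇒Reached c r)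

  Reached⇒Edge : ∀ {k} → Reached k → δ (suc k) ≡ a ∸ 1 → Edge a δ n k
  Reached⇒Edge (source a≤δk) e     = base a≤δk (≤-reflexive (sym e))
  Reached⇒Edge (extend e′ r) e     = chain e′ e (Reached⇒Edge r e′)
  Reached⇒Edge {k} (wrap r) e      = wrap (Reached⇒Edge r (trans (δ-periodic (suc k)) e))

  Reached⇒InComponent : ∀ {k} → Reached k → InComponent k
  Reached⇒InComponent (source a≤δk) = _ , here , a≤δk
  Reached⇒InComponent (extend e r) with Reached⇒InComponent r
  ... | j , c , a≤δj = j , bwd (Reached⇒Edge r e) c , a≤δj
  Reached⇒InComponent (wrap r) with Reached⇒InComponent r
  ... | j , c , a≤δj = j , up c , a≤δj

  InComponent⇔Reached : ∀ k → InComponent k ⇔ Reached k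
  InComponent⇔Reached k = mk⇔ (λ (_ , c , a≤δj) → Conn⇒Reached c (source a≤δj)) Reached⇒InComponent

  Reached-suc⁻¹ : ∀ {k} → Reached (suc k) → a ≤ δ (suc k) ⊎ (δ (suc k) ≡ a ∸ 1 × Reached k)
  Reached-suc⁻¹ (source a≤δk) = inj₁ a≤δk
  Reached-suc⁻¹ (extend e r)  = inj₂ (e , r)
  Reached-suc⁻¹ {k} (wrap r) with Reached-suc⁻¹ r
  ... | inj₁ a≤δ      = inj₁ (subst (a ≤_) (δ-periodic (suc k)) a≤δ)
  ... | inj₂ (e , r′) = inj₂ (trans (sym (δ-periodic (suc k))) e , wrap r′)

  Reached-suc⇔ : ∀ k → Reached (suc k) ⇔ (a ≤ δ (suc k) ⊎ (δ (suc k) ≡ a ∸ 1 × Reached k))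
  Reached-suc⇔ k = mk⇔ Reached-suc⁻¹ [ source , (λ (e , r) → extend e r) ]

module AddHat (a′ c′ m : ℕ) (α : Fin (suc m) → ℕ) (S : Subset (suc m))
              (α<p : ∀ i → α i < suc a′ + suc c′)
              (S-spec : ∀ i → (i ∈ S → InCirc (suc a′) α (toℕ i)) × (InCirc (suc a′) α (toℕ i) → i ∈ S)) where

  n a c p : ℕ
  n = suc m
  a = suc a′
  c = suc c′
  p = a + c

  δ : ℕ → ℕ
  δ = digit α

  x : ℕ → Bool
  x = cyclic (lookup S)

  X : ℕ → ℕ
  X k = 𝟙 (x k)

  open Components a δ n (cyclic-+n α)

  x⇔Reached : ∀ k → x k ≡ true ⇔ Reached k
  x⇔Reached k = begin
    lookup S i ≡ true  ∼⟨ mk⇔ (lookup⇒[]= i S) []=⇒lookup ⟩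
    i ∈ S              ∼⟨ mk⇔ (proj₁ (S-spec i)) (proj₂ (S-spec i)) ⟩
    InCirc a α (toℕ i) ∼⟨ InComponent⇔Reached (toℕ i) ⟩
    Reached (toℕ i)    ≡⟨ cong Reached (toℕ-fromℕ< _) ⟩
    Reached (k % n)    ∼⟨ Reached-%⇔ k ⟩
    Reached k          ∎
    where
    open EquationalReasoning
    i : Fin n
    i = fromℕ< (m%n<n k n)

  carry⇔ : ∀ k → x (suc k) ≡ true ⇔ a ≤ δ (suc k) + X k
  carry⇔ k = begin
    x (suc k) ≡ true                                    ∼⟨ x⇔Reached (suc k) ⟩
    Reached (suc k)                                     ∼⟨ Reached-suc⇔ k ⟩
    (a ≤ δ (suc k) ⊎ (δ (suc k) ≡ a ∸ 1 × Reached k))   ∼⟨ ⇔-refl ⊎-⇔ (⇔-refl ×-⇔ ⇔-sym (x⇔Reached k)) ⟩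
    (a ≤ δ (suc k) ⊎ (δ (suc k) ≡ a ∸ 1 × x k ≡ true))  ∼⟨ ≤+𝟙⇔ a (δ (suc k)) (x k) ⟩
    a ≤ δ (suc k) + X k                                 ∎
    where open EquationalReasoning

  column : ℕ → ℕ
  column k = δ k + c + X (k + m)

  previous : ∀ {A : Set} (f : Fin n → A) k → cyclic f (suc (k + m)) ≡ cyclic f k
  previous f k = trans (cong (cyclic f) (sym (+-suc k m))) (cyclic-+n f k)

  overflow⇔ : ∀ k → x k ≡ true ⇔ p ≤ column k
  overflow⇔ k = begin
    x k ≡ true                      ≡⟨ cong (_≡ true) (previous (lookup S) k) ⟨
    x (suc (k + m)) ≡ true          ∼⟨ carry⇔ (k + m) ⟩
    a ≤ δ (suc (k + m)) + X (k + m) ≡⟨ cong (λ d → a ≤ d + X (k + m)) (previous α k) ⟩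
    a ≤ δ k + X (k + m)             ∼⟨ mk⇔ (+-monoˡ-≤ c) (+-cancelʳ-≤ c a _) ⟩
    a + c ≤ δ k + X (k + m) + c     ≡⟨ cong (p ≤_) (xy∙z≈xz∙y (δ k) (X (k + m)) c) ⟩
    p ≤ column k                    ∎
    where open EquationalReasoning

  column<p+p : ∀ k → column k < p + p
  column<p+p k = begin-strict
    δ k + c + X (k + m)   ≡⟨ +-assoc (δ k) c _ ⟩
    δ k + (c + X (k + m)) <⟨ +-mono-<-≤ (α<p _) c+X≤p ⟩
    p + p                 ∎
    where
    open ≤-Reasoning
    𝟙≤a : ∀ b → 𝟙 b ≤ a
    𝟙≤a false = z≤n
    𝟙≤a true  = s≤s z≤n
    c+X≤p : c + X (k + m) ≤ p
    c+X≤p = subst (_≤ p) (+-comm (X (k + m)) c) (+-monoˡ-≤ c (𝟙≤a (x (k + m))))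

  Γ : ℕ → ℕ
  Γ k = column k % p

  Γ<p : ∀ k → Γ k < p
  Γ<p k = m%n<n (column k) p

  column≡digit+carry : ∀ k → δ k + c + X (k + m) ≡ Γ k + X k * p
  column≡digit+carry k = trans (m≡m%n+[m/n]*n (column k) p)
                    (cong (λ q → Γ k + q * p) (sym (𝟙≡/ (x k) (column<p+p k) (overflow⇔ k))))

  open EndAroundCarry p m (λ k → δ k + c) Γ X (λ k → cong 𝟙 (cyclic-+n (lookup S) k)) column≡digit+carry

  digit-sum-identity : ∑ n Γ + ∑ n X * (p ∸ 1) ≡ ∑ n δ + c * n
  digit-sum-identity = +-cancelʳ-≡ (∑ n X) _ _ (begin
    ∑ n Γ + ∑ n X * (p ∸ 1) + ∑ n X ≡⟨ *-suc-right (∑ n Γ) (∑ n X) (p ∸ 1) ⟩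
    ∑ n Γ + ∑ n X * p               ≡⟨ ∑-end-around ⟩
    ∑ n (λ k → δ k + c) + ∑ n X     ≡⟨ cong (_+ ∑ n X) (∑-distrib-+ n δ (λ _ → c)) ⟩
    ∑ n δ + ∑ n (λ _ → c) + ∑ n X   ≡⟨ cong (λ y → ∑ n δ + y + ∑ n X) (∑-const n c) ⟩
    ∑ n δ + c * n + ∑ n X           ∎)
    where
    open ≡-Reasoning
    *-suc-right : ∀ g y q → g + y * q + y ≡ g + y * suc q
    *-suc-right = solve-∀

  value-identity : positional p n δ + hat p n c ≡ positional p n Γ + X m * (p ^ n ∸ 1)
  value-identity = +-cancelʳ-≡ (X m) _ _ (begin
    positional p n δ + hat p n c + X m         ≡⟨ cong (_+ X m) (positional-+hat p n δ c) ⟨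
    positional p n (λ k → δ k + c) + X m       ≡⟨ positional-end-around ⟨
    positional p n Γ + X m * p ^ n             ≡⟨ cong (λ q → positional p n Γ + X m * q) (m∸n+n≡m (m^n>0 p n)) ⟨
    positional p n Γ + X m * (p ^ n ∸ 1 + 1)   ≡⟨ *-suc-right (positional p n Γ) (X m) (p ^ n ∸ 1) ⟩
    positional p n Γ + X m * (p ^ n ∸ 1) + X m ∎)
    where
    open ≡-Reasoning
    *-suc-right : ∀ g y q → g + y * (q + 1) ≡ g + y * q + y
    *-suc-right = solve-∀

  -- If every digit vanished, every column would carry; a column with δ j ≥ a, which exists
  -- since then 𝒢_a(α)° is nonempty, would have column sum above p.
  positional-Γ>0 : 0 < positional p n Γ
  positional-Γ>0 = n≢0⇒n>0 λ positional≡0 →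
    not-all-zero (positional-injective n Γ<p (λ _ → z<s) (trans positional≡0 (sym (∑-const n 0))))
    where
    column>0 : ∀ k → 0 < column k
    column>0 k = ≤-trans (s≤s z≤n) (≤-trans (m≤n+m c (δ k)) (m≤m+n (δ k + c) (X (k + m))))
    not-all-zero : ¬ (∀ k → k < n → Γ k ≡ 0)
    not-all-zero Γ≡0 = <-irrefl refl (begin-strict
      p                 <⟨ m<m+n p z<s ⟩
      a + c + 1         ≤⟨ +-monoˡ-≤ 1 (+-monoˡ-≤ c a≤δj′) ⟩
      δ j′ + c + 1      ≡⟨ cong (δ j′ + c +_) (cong 𝟙 (carries (j′ + m))) ⟨
      column j′         ≡⟨ column≡digit+carry j′ ⟩
      Γ j′ + X j′ * p   ≡⟨ cong₂ (λ g y → g + y * p) (Γ≡0 j′ (m%n<n j n)) (cong 𝟙 (carries j′)) ⟩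
      0 + 1 * p         ≡⟨ *-identityˡ p ⟩
      p                 ∎)
      where
      open ≤-Reasoning
      carries-below : ∀ k → k < n → x k ≡ true
      carries-below k k<n with x k | column≡digit+carry k
      ... | true  | _  = refl
      ... | false | eq = contradiction (sym (trans eq (cong (_+ 0) (Γ≡0 k k<n)))) (<⇒≢ (column>0 k))
      carries : ∀ k → x k ≡ true
      carries k = trans (sym (cyclic-% (lookup S) k)) (carries-below (k % n) (m%n<n k n))
      source-vertex : InComponent 0
      source-vertex = Reached⇒InComponent (Equivalence.to (x⇔Reached 0) (carries 0))
      j j′ : ℕ
      j = proj₁ source-vertex
      j′ = j % n
      a≤δj′ : a ≤ δ j′
      a≤δj′ = subst (a ≤_) (sym (cyclic-% α j)) (proj₂ (proj₂ source-vertex))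

  residue-digits≡Γ : (β : Fin n → ℕ) (u w : ℕ) → (∀ i → β i < p) → 0 < value p β →
                     value p β + u * (p ^ n ∸ 1) ≡ value p α + hat p n c + w * (p ^ n ∸ 1) →
                     ∀ k → k < n → digit β k ≡ Γ k
  residue-digits≡Γ β u w β<p value-β>0 congruence =
    positional-≡-mod-injective n u (X m + w) (λ _ → β<p _) Γ<p
      (subst (0 <_) (value≡positional p β) value-β>0) positional-Γ>0 (begin
        positional p n (digit β) + u * M     ≡⟨ cong (_+ u * M) (value≡positional p β) ⟨
        value p β + u * M                    ≡⟨ congruence ⟩
        value p α + hat p n c + w * M        ≡⟨ cong (λ v → v + hat p n c + w * M) (value≡positional p α) ⟩
        positional p n δ + hat p n c + w * M ≡⟨ cong (_+ w * M) value-identity ⟩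
        positional p n Γ + X m * M + w * M   ≡⟨ +-assoc (positional p n Γ) _ _ ⟩
        positional p n Γ + (X m * M + w * M) ≡⟨ cong (positional p n Γ +_) (*-distribʳ-+ M (X m) w) ⟨
        positional p n Γ + (X m + w) * M     ∎)
    where
    open ≡-Reasoning
    M : ℕ
    M = p ^ n ∸ 1

m<n∸1⇒∃[o]n≡suc[m]+suc[o] : ∀ m n → suc m ≤ n ∸ 1 → ∃ λ o → n ≡ suc m + suc o
m<n∸1⇒∃[o]n≡suc[m]+suc[o] m (suc n) m<n with m≤n⇒∃[o]m+o≡n m<n
... | o , refl = o , sym (+-suc (suc m) o)

lemma4p10 : (p : ℕ) → Prime p → (n : ℕ) → .{{_ : NonZero n}} →
            (α : Fin n → ℕ) → (∀ i → α i < p) →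
            (a : ℕ) → 1 ≤ a → a ≤ p ∸ 1 →
            (β : Fin n → ℕ) → (∀ i → β i < p) → 0 < value p β →
            value p β ≡ value p α + hat p n (p ∸ a) [mod (p ^ n ∸ 1) ] →
            (S : Subset n) →
            (∀ i → (i ∈ S → InCirc a α (toℕ i)) × (InCirc a α (toℕ i) → i ∈ S)) →
            s β + ∣ S ∣ * (p ∸ 1) ≡ s α + (p ∸ a) * n
lemma4p10 p _ (suc m) α α<p (suc a′) (s≤s z≤n) a≤p∸1 β β<p value-β>0 (u , w , congruence) S S-spec
  with m<n∸1⇒∃[o]n≡suc[m]+suc[o] a′ p a≤p∸1
... | c′ , refl = begin
  s β + ∣ S ∣ * (p ∸ 1)            ≡⟨ cong₂ (λ σ κ → σ + κ * (p ∸ 1)) (s≡∑cyclic β) ∣S∣≡∑X ⟩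
  ∑ n (digit β) + ∑ n X * (p ∸ 1)  ≡⟨ cong (_+ ∑ n X * (p ∸ 1)) (∑-cong n β≡Γ) ⟩
  ∑ n Γ + ∑ n X * (p ∸ 1)          ≡⟨ digit-sum-identity ⟩
  ∑ n δ + c * n                    ≡⟨ cong₂ (λ σ d → σ + d * n) (s≡∑cyclic α) (m+n∸m≡n a c) ⟨
  s α + (p ∸ a) * n                ∎
  where
  open AddHat a′ c′ m α S α<p S-spec hiding (p)
  open ≡-Reasoning
  ∣S∣≡∑X : ∣ S ∣ ≡ ∑ n X
  ∣S∣≡∑X = trans (∣S∣≡s𝟙 S) (s≡∑cyclic (𝟙 ∘ lookup S))
  β≡Γ : ∀ k → k < n → digit β k ≡ Γ k
  β≡Γ = residue-digits≡Γ β u w β<p value-β>0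
          (subst (λ d → value p β + u * M ≡ value p α + hat p n d + w * M) (m+n∸m≡n a c) congruence)
    where
    M : ℕ
    M = p ^ n ∸ 1
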